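{- Let $n$ be a positive integer and $C_n=\prod_{k=1}^n(k^3+1)$. If $p$ is a prime with $p>n+1$ that divides $C_n$, then $\mathrm{ord}_p(C_n)\leq 2$.
   Context: For a prime $p$ and a positive integer $m$, $\mathrm{ord}_p(m)$ denotes the exponent of $p$ in the prime factorization of $m$. -}

module Defs where

open import Data.Nat using (ℕ; zero; suc; _+_; _*_; _^_)
open import Data.Nat.Divisibility using (_∣_)
open import Data.Product using (_×_)
open import Relation.Nullary using (¬_)

C : ℕ → ℕ
C zero = 1
C (suc n) = C n * (suc n ^ 3 + 1)

Ord : ℕ → ℕ → ℕ → Set
Ord p m k = (p ^ k ∣ m) × ¬ (p ^ suc k ∣ m)

module Submission where

-- Writing k = j + 1, every factor of C n splits as
--   (j + 1)³ + 1 = (j + 2) * q j,   where q j = j² + j + 1,   0 ≤ j < n.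
-- Let p be a prime with n + 1 < p.  Then p never divides j + 2 ≤ n + 1, and
-- p² never divides q j because q j < (j + 1)² < p².  Hence each factor of
-- C n contributes p at most once, namely exactly when p ∣ q j, so the
-- exponent of p in C n is at most the number of roots j < n of q mod p.
-- Finally, two roots a < b (with b + 1 < p) satisfy p ∣ (b - a)(a + b + 1),
-- hence a + b + 1 = p; so a third root c > b would give a + c + 1 = p as
-- well, forcing b = c.  Thus there are at most two roots.

open import Defs
open import Data.Nat using (ℕ; zero; suc; _+_; _*_; _^_; _≤_; _<_; _≤?_; z≤n; s≤s; s≤s⁻¹; z<s)
open import Data.Nat.Properties
open import Algebra.Properties.CommutativeSemigroup *-commutativeSemigroup
  using (x∙yz≈y∙xz; xy∙z≈y∙xz)
open import Data.Nat.Divisibility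
open import Data.Nat.Primality using (Prime; euclidsLemma; prime⇒nonZero; ¬prime[1])
open import Data.Nat.Tactic.RingSolver using (solve-∀)
open import Data.Product using (_×_; _,_; ∃-syntax)
open import Data.Sum using (inj₁; inj₂)
open import Relation.Nullary using (¬_; yes; no; contradiction)
open import Relation.Unary using (Decidable)
open import Relation.Binary.PropositionalEquality
  using (_≡_; refl; sym; trans; cong; subst; module ≡-Reasoning)

count : {P : ℕ → Set} → Decidable P → ℕ → ℕ
count P? zero = 0
count P? (suc n) with P? n
... | yes _ = suc (count P? n)
... | no  _ = count P? n

last-witness : {P : ℕ → Set} (P? : Decidable P) {k : ℕ} (n : ℕ) →
               suc k ≤ count P? n → ∃[ j ] j < n × P j × k ≤ count P? j
last-witness P? (suc n) h with P? n
... | yes Pn = n , n<1+n n , Pn , s≤s⁻¹ h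
... | no  _  with last-witness P? n h
...   | j , j<n , Pj , k≤ = j , m<n⇒m<1+n j<n , Pj , k≤

three-witnesses : {P : ℕ → Set} (P? : Decidable P) (n : ℕ) → 3 ≤ count P? n →
                  ∃[ a ] ∃[ b ] ∃[ c ] a < b × b < c × c < n × P a × P b × P c
three-witnesses P? n h with last-witness P? n h
... | c , c<n , Pc , h₂ with last-witness P? c h₂
... | b , b<c , Pb , h₁ with last-witness P? b h₁
... | a , a<b , Pa , _  = a , b , c , a<b , b<c , c<n , Pa , Pb , Pc

∤-below : ∀ {p x} → 0 < x → x < p → ¬ p ∣ x
∤-below {x = suc _} _ x<p = >⇒∤ x<p

∤-* : ∀ {p a b} → Prime p → ¬ p ∣ a → ¬ p ∣ b → ¬ p ∣ a * b
∤-* {a = a} {b} pp p∤a p∤b p∣ab with euclidsLemma a b pp p∣ab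
... | inj₁ p∣a = p∤a p∣a
... | inj₂ p∣b = p∤b p∣b

sole-multiple : ∀ {p x} → p ∣ x → 0 < x → x < p + p → x ≡ p
sole-multiple (divides zero refl) () _
sole-multiple {p} (divides (suc zero) refl) _ _ = +-identityʳ p
sole-multiple {p} (divides (suc (suc k)) refl) _ x<2p =
  contradiction (+-monoʳ-≤ p (m≤m+n p (k * p))) (<⇒≱ x<2p)

strip-coprime : ∀ {p B} → Prime p → ¬ p ∣ B → ∀ e {A} → p ^ e ∣ A * B → p ^ e ∣ A
strip-coprime pp p∤B zero _ = 1∣ _
strip-coprime {p} {B} pp p∤B (suc e) {A} h
  with euclidsLemma A B pp (∣-trans (m∣m*n (p ^ e)) h)
... | inj₂ p∣B = contradiction p∣B p∤B
... | inj₁ (divides A′ refl) = subst (p ^ suc e ∣_) (*-comm p A′) (*-monoʳ-∣ p p^e∣A′)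
  where
  instance _ = prime⇒nonZero pp
  p^e∣A′ : p ^ e ∣ A′
  p^e∣A′ = strip-coprime pp p∤B e (*-cancelˡ-∣ p (subst (p * p ^ e ∣_) (xy∙z≈y∙xz A′ p B) h))

cancel-p : ∀ {p} → Prime p → ∀ e A u → p ^ suc e ∣ A * (p * u) → p ^ e ∣ A * u
cancel-p {p} pp e A u h =
  *-cancelˡ-∣ p ⦃ prime⇒nonZero pp ⦄ (subst (p * p ^ e ∣_) (x∙yz≈y∙xz A p u) h)

q : ℕ → ℕ
q j = suc (j * j + j)

cube-plus-one : ∀ j → suc j ^ 3 + 1 ≡ (j + 2) * q j
cube-plus-one = expanded
  where
  expanded : ∀ j → (1 + j) * ((1 + j) * ((1 + j) * 1)) + 1 ≡ (j + 2) * (1 + (j * j + j))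
  expanded = solve-∀

-- q j + j = (j + 1)², so q j < p² as soon as j + 1 < p.
q<square : ∀ {p j} → j + 1 < p → q j < p * p
q<square {p} {j} j+1<p = begin-strict
  q j               ≤⟨ m≤m+n (q j) j ⟩
  q j + j           ≡⟨ square j ⟩
  (j + 1) * (j + 1) <⟨ *-mono-< j+1<p j+1<p ⟩
  p * p             ∎
  where
  open ≤-Reasoning
  square : ∀ j → 1 + (j * j + j) + j ≡ (j + 1) * (j + 1)
  square = solve-∀

exactly-once : ∀ {p j} → j + 1 < p → p ∣ q j → ∃[ t ] q j ≡ p * t × ¬ p ∣ t
exactly-once {p} {j} j+1<p (divides t qj≡tp) = t , trans qj≡tp (*-comm t p) , p∤t
  where
  p∤t : ¬ p ∣ t
  p∤t p∣t = >⇒∤ (q<square j+1<p) (subst (p * p ∣_) (sym qj≡tp) (*-pres-∣ p∣t ∣-refl))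

-- Two roots a < b of q modulo p with b + 1 < p are paired: 1 + a + b = p.
-- Indeed q b - q a = (b - a)(a + b + 1) and p ∤ b - a.
paired-roots : ∀ {p a b} → Prime p → p ∣ q a → p ∣ q b → a < b → b + 1 < p → 1 + a + b ≡ p
paired-roots {p} {a} pp p∣qa p∣qb a<b b+1<p with m≤n⇒∃[o]m+o≡n a<b
... | k , refl = sole-multiple p∣sum z<s sum<2p
  where
  b = suc a + k
  difference : ∀ a k → 1 + ((1 + a + k) * (1 + a + k) + (1 + a + k))
                     ≡ 1 + (a * a + a) + (1 + k) * (1 + a + (1 + a + k))
  difference = solve-∀
  b<p : b < p
  b<p = <-trans (m<m+n b z<s) b+1<p
  p∣sum : p ∣ 1 + a + b
  p∣sum with euclidsLemma (suc k) (1 + a + b) pp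
               (∣m+n∣m⇒∣n (subst (p ∣_) (difference a k) p∣qb) p∣qa)
  ... | inj₁ p∣k+1 = contradiction p∣k+1 (∤-below z<s (≤-<-trans (s≤s (m≤n+m k a)) b<p))
  ... | inj₂ p∣sum = p∣sum
  sum<2p : 1 + a + b < p + p
  sum<2p = subst (_< p + p) (regroup a b) (+-mono-< (<-trans a<b b<p) b+1<p)
    where
    regroup : ∀ a b → a + (b + 1) ≡ 1 + a + b
    regroup = solve-∀

∤-j+2 : ∀ {p j} → suc j + 1 < p → ¬ p ∣ j + 2
∤-j+2 {p} {j} j+2<p =
  ∤-below (≤-trans (s≤s z≤n) (m≤n+m 2 j)) (subst (_< p) (sym (+-suc j 1)) j+2<p)

factor-without-root : ∀ {p j} → Prime p → suc j + 1 < p → ¬ p ∣ q j → ¬ p ∣ suc j ^ 3 + 1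
factor-without-root {p} {j} pp j+2<p p∤qj p∣factor =
  ∤-* pp (∤-j+2 j+2<p) p∤qj (subst (p ∣_) (cube-plus-one j) p∣factor)

factor-with-root : ∀ {p j} → Prime p → suc j + 1 < p → p ∣ q j →
                   ∃[ u ] suc j ^ 3 + 1 ≡ p * u × ¬ p ∣ u
factor-with-root {p} {j} pp j+2<p p∣qj with exactly-once (<-trans (n<1+n (j + 1)) j+2<p) p∣qj
... | t , qj≡pt , p∤t = (j + 2) * t , factored , ∤-* pp (∤-j+2 j+2<p) p∤t
  where
  open ≡-Reasoning
  factored : suc j ^ 3 + 1 ≡ p * ((j + 2) * t)
  factored = begin
    suc j ^ 3 + 1     ≡⟨ cube-plus-one j ⟩
    (j + 2) * q j     ≡⟨ cong ((j + 2) *_) qj≡pt ⟩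
    (j + 2) * (p * t) ≡⟨ x∙yz≈y∙xz (j + 2) p t ⟩
    p * ((j + 2) * t) ∎

roots : ℕ → ℕ → ℕ
roots p = count (λ j → p ∣? q j)

-- Each factor (j + 1)³ + 1 of C n carries p at most once, and only when p
-- divides q j; so the exponent of p in C n is at most roots p n.
exponent≤roots : ∀ {p} → Prime p → ∀ n → n + 1 < p → ∀ e → p ^ e ∣ C n → e ≤ roots p n
exponent≤roots pp _ _ zero _ = z≤n
exponent≤roots {p} pp zero _ (suc e) p^e+1∣1 =
  contradiction (subst Prime (∣1⇒≡1 (∣-trans (m∣m*n (p ^ e)) p^e+1∣1)) pp) ¬prime[1]
exponent≤roots {p} pp (suc n) n+2<p (suc e) p^e+1∣C with p ∣? q n
... | no p∤qn = exponent≤roots pp n (<-trans (n<1+n (n + 1)) n+2<p) (suc e)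
                  (strip-coprime pp (factor-without-root pp n+2<p p∤qn) (suc e) p^e+1∣C)
... | yes p∣qn with factor-with-root pp n+2<p p∣qn
...   | u , factor≡pu , p∤u = s≤s (exponent≤roots pp n (<-trans (n<1+n (n + 1)) n+2<p) e
                                 (strip-coprime pp p∤u e (cancel-p pp e (C n) u p^e+1∣Cnpu)))
  where
  p^e+1∣Cnpu : p ^ suc e ∣ C n * (p * u)
  p^e+1∣Cnpu = subst (λ x → p ^ suc e ∣ C n * x) factor≡pu p^e+1∣C

-- Three roots a < b < c below n would give 1 + a + b = p = 1 + a + c.
roots≤2 : ∀ {p} → Prime p → ∀ n → n + 1 < p → roots p n ≤ 2
roots≤2 {p} pp n n+1<p with roots p n ≤? 2
... | yes ≤2 = ≤2
... | no  ≰2 with three-witnesses (λ j → p ∣? q j) n (≰⇒> ≰2)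
...   | a , b , c , a<b , b<c , c<n , p∣qa , p∣qb , p∣qc =
  contradiction (+-cancelˡ-≡ (suc a) b c a+b≡a+c) (<⇒≢ b<c)
  where
  c+1<p : c + 1 < p
  c+1<p = ≤-<-trans (+-monoˡ-≤ 1 (<⇒≤ c<n)) n+1<p
  b+1<p : b + 1 < p
  b+1<p = <-trans (+-monoˡ-< 1 b<c) c+1<p
  a+b≡a+c : 1 + a + b ≡ 1 + a + c
  a+b≡a+c = trans (paired-roots pp p∣qa p∣qb a<b b+1<p)
                  (sym (paired-roots pp p∣qa p∣qc (<-trans a<b b<c) c+1<p))

lemma2p2 : (n p : ℕ) → 1 ≤ n → Prime p → n + 1 < p → p ∣ C n →
           ∀ k → Ord p (C n) k → k ≤ 2
lemma2p2 n p _ pp n+1<p _ k (p^k∣C , _) =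
  ≤-trans (exponent≤roots pp n n+1<p k p^k∣C) (roots≤2 pp n n+1<p)
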